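{- Let $\langle\mathcal{V},\mathcal{W},[\![\cdot]\!]\rangle$ be a sound and complete intersective mixed semantics for a sentential logic $\langle\mathcal{L},\mathcal{C},\vdash\rangle$, with truth-relation $\bigcap_{\lambda\in\Lambda}\Vdash_{D_p^\lambda,D_c^\lambda}$, where each $\lambda=(D_p^\lambda,D_c^\lambda)$. Then its Scott-Suszko reduction (defined below) is a sound and complete mixed semantics for the same logic.
   Context: A sentential logic is a triple $\langle\mathcal{L},\mathcal{C},\vdash\rangle$ where $\mathcal{L}$ is the set of formulae freely generated from a set of atoms by a set $\mathcal{C}$ of connectives, and $\vdash\subseteq\mathcal{P}(\mathcal{L})\times\mathcal{P}(\mathcal{L})$. A semantics is a triple $\langle\mathcal{V},\mathcal{W},[\![\cdot]\!]\rangle$: truth values $\mathcal{V}$, worlds $\mathcal{W}$, and $[\![\cdot]\!]$ assigning to formulae propositions $\mathcal{W}\to\mathcal{V}$, to $n$-ary connectives functions on $n$-tuples of propositions, and to $\vdash$ a relation $\models$ between sets of propositions. It is sound and complete if $\Gamma\vdash\Delta$ iff $\{[\![F]\!]:F\in\Gamma\}\models\{[\![F]\!]:F\in\Delta\}$. It is truth-relational if there is $\Vdash\subseteq\mathcal{P}(\mathcal{V})\times\mathcal{P}(\mathcal{V})$ (the truth-relation) with $S\models P$ iff $S(w)\Vdash P(w)$ for all $w\in\mathcal{W}$, where $S(w)=\{Q(w):Q\in S\}$. For $D_p,D_c\subseteq\mathcal{V}$, $\gamma\Vdash_{D_p,D_c}\delta$ iff ($\gamma\subseteq D_p$ implies $\delta\cap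 D_c\neq\emptyset$). A semantics is mixed if it is truth-relational with truth-relation of the form $\Vdash_{D_p,D_c}$, and intersective mixed if it is truth-relational with truth-relation an intersection of such relations. The Scott-Suszko reduction of the given semantics is the semantics with truth values $\mathcal{V}^*=\{1,\#_p,\#_c,0\}$ (four distinct objects), worlds $\mathcal{W}^*=\Lambda\times\mathcal{W}$, truth-relation $\Vdash^*=\Vdash_{\{1,\#_p\},\{1,\#_c\}}$ (so $\models^*$ is defined by $S\models^*P$ iff $S(w)\Vdash^*P(w)$ for all $w\in\mathcal{W}^*$), formula interpretation $[\![F]\!]^*(\lambda,v)=t_\lambda([\![F]\!](v))$, where $t_\lambda(\alpha)=1$ if $\alpha\in D_p^\lambda\cap D_c^\lambda$, $0$ if $\alpha\notin D_p^\lambda\cup D_c^\lambda$, $\#_p$ if $\alpha\in D_p^\lambda\setminus D_c^\lambda$, $\#_c$ if $\alpha\in D_c^\lambda\setminus D_p^\lambda$; connectives are interpreted arbitrarily. -}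

module Defs where

open import Level using (0ℓ)
open import Data.Nat using (ℕ)
open import Data.Fin using (Fin)
open import Data.Product using (Σ; ∃; _×_; _,_)
open import Relation.Nullary using (¬_)
open import Relation.Unary using (Pred; _∈_; _⊆_)
open import Relation.Binary.PropositionalEquality using (_≡_)
open import Function.Bundles using (_⇔_)

data Formula (Atom : Set) (C : Set) (ar : C → ℕ) : Set where
  atom : Atom → Formula Atom C ar
  con  : (c : C) → (Fin (ar c) → Formula Atom C ar) → Formula Atom C ar

record Logic : Set₁ where
  field
    Atom : Set
    Con  : Set
    ar   : Con → ℕ
    _⊢_  : Pred (Formula Atom Con ar) 0ℓ → Pred (Formula Atom Con ar) 0ℓ → Set

record Semantics (L : Logic) : Set₁ where
  open Logic L
  field
    V     : Set
    W     : Set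
    ⟦_⟧   : Formula Atom Con ar → (W → V)
    ⟦_⟧c  : (c : Con) → (Fin (ar c) → (W → V)) → (W → V)
    _⊨_   : Pred (W → V) 0ℓ → Pred (W → V) 0ℓ → Set

image : {L : Logic} (M : Semantics L) →
        Pred (Formula (Logic.Atom L) (Logic.Con L) (Logic.ar L)) 0ℓ →
        Pred (Semantics.W M → Semantics.V M) 0ℓ
image M Γ P = ∃ λ F → F ∈ Γ × Semantics.⟦_⟧ M F ≡ P

SoundComplete : {L : Logic} → Semantics L → Set₁
SoundComplete {L} M = ∀ Γ Δ → (Γ ⊢ Δ) ⇔ (image M Γ ⊨ image M Δ)
  where open Logic L
        open Semantics M

at : {W V : Set} → Pred (W → V) 0ℓ → W → Pred V 0ℓ
at S w α = ∃ λ Q → Q ∈ S × Q w ≡ α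

⊩[_,_] : {V : Set} → Pred V 0ℓ → Pred V 0ℓ → Pred V 0ℓ → Pred V 0ℓ → Set
⊩[ Dp , Dc ] γ δ = γ ⊆ Dp → ∃ λ α → α ∈ δ × α ∈ Dc

TruthRelationalWith : {L : Logic} (M : Semantics L) →
                      (Pred (Semantics.V M) 0ℓ → Pred (Semantics.V M) 0ℓ → Set) → Set₁
TruthRelationalWith M _⊩_ =
  ∀ S P → (S ⊨ P) ⇔ (∀ w → at S w ⊩ at P w)
  where open Semantics M

TruthRelational : {L : Logic} → Semantics L → Set₁
TruthRelational M = Σ (Pred (Semantics.V M) 0ℓ → Pred (Semantics.V M) 0ℓ → Set)
                      (TruthRelationalWith M)

Mixed : {L : Logic} → Semantics L → Set₁
Mixed M = Σ (Pred (Semantics.V M) 0ℓ) λ Dp → Σ (Pred (Semantics.V M) 0ℓ) λ Dc →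
            TruthRelationalWith M ⊩[ Dp , Dc ]

⋂⊩ : {V Λ : Set} → (Λ → Pred V 0ℓ) → (Λ → Pred V 0ℓ) → Pred V 0ℓ → Pred V 0ℓ → Set
⋂⊩ Dp Dc γ δ = ∀ l → ⊩[ Dp l , Dc l ] γ δ

-- The four Scott–Suszko truth values 1, #p, #c, 0.
data V* : Set where
  one hp hc zero : V*

Dp* : Pred V* 0ℓ
Dp* x = (x ≡ one) Data.Sum.⊎ (x ≡ hp)
  where import Data.Sum

Dc* : Pred V* 0ℓ
Dc* x = (x ≡ one) Data.Sum.⊎ (x ≡ hc)
  where import Data.Sum

-- Graph of t_λ : V → V*, with D_p = Dp, D_c = Dc:
-- t(α) = 1 if α ∈ Dp ∩ Dc, 0 if α ∉ Dp ∪ Dc, #p if α ∈ Dp \ Dc, #c if α ∈ Dc \ Dp.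
data IsT {V : Set} (Dp Dc : Pred V 0ℓ) (α : V) : V* → Set where
  t-one  : α ∈ Dp → α ∈ Dc → IsT Dp Dc α one
  t-hp   : α ∈ Dp → ¬ (α ∈ Dc) → IsT Dp Dc α hp
  t-hc   : ¬ (α ∈ Dp) → α ∈ Dc → IsT Dp Dc α hc
  t-zero : ¬ (α ∈ Dp) → ¬ (α ∈ Dc) → IsT Dp Dc α zero

-- The Scott–Suszko reduction, given the interpretation of formulae ⟦·⟧*
-- (required to satisfy ⟦F⟧*(λ,v) = t_λ(⟦F⟧(v)), see theorem) and an arbitrary
-- interpretation of the connectives.
SSReduction : {L : Logic} (M : Semantics L) (Λ : Set) →
  (Formula (Logic.Atom L) (Logic.Con L) (Logic.ar L) → (Λ × Semantics.W M) → V*) →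
  ((c : Logic.Con L) → (Fin (Logic.ar L c) → ((Λ × Semantics.W M) → V*)) →
     ((Λ × Semantics.W M) → V*)) →
  Semantics L
SSReduction M Λ int intc = record
  { V = V*
  ; W = Λ × Semantics.W M
  ; ⟦_⟧ = int
  ; ⟦_⟧c = intc
  ; _⊨_ = λ S P → ∀ w → ⊩[ Dp* , Dc* ] (at S w) (at P w)
  }

-- A formula's Scott–Suszko value at (λ, v) is designated as a premise (resp.
-- conclusion) exactly when its original value at v lies in D_p^λ (resp. D_c^λ).
-- Since ⊩_{Dp,Dc} only looks at which values are designated, the reduction's
-- consequence at (λ, v) coincides with ⊩_{D_p^λ, D_c^λ} at v; quantifying over
-- all (λ, v) recovers the intersective truth-relation, hence ⊢.
module Submission where

open import Defs
open import Level using (0ℓ)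
open import Data.Fin using (Fin)
open import Data.Product using (∃; _×_; _,_; uncurry)
open import Data.Sum using (inj₁; inj₂)
open import Relation.Unary using (Pred; _∈_; _⊆_)
open import Relation.Binary.PropositionalEquality using (refl)
open import Function.Base using (_∘_)
open import Function.Bundles using (_⇔_; mk⇔; Equivalence)
open import Function.Construct.Composition using (_⇔-∘_)
open import Function.Construct.Identity using (⇔-id)
open import Data.Empty using (⊥-elim)

module _ {V : Set} {Dp Dc : Pred V 0ℓ} where

  IsT⇒Dp⇔Dp* : ∀ {α x} → IsT Dp Dc α x → Dp α ⇔ Dp* x
  IsT⇒Dp⇔Dp* (t-one p _)  = mk⇔ (λ _ → inj₁ refl) (λ _ → p)
  IsT⇒Dp⇔Dp* (t-hp p _)   = mk⇔ (λ _ → inj₂ refl) (λ _ → p)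
  IsT⇒Dp⇔Dp* (t-hc ¬p _)  = mk⇔ (λ p → ⊥-elim (¬p p)) λ { (inj₁ ()) ; (inj₂ ()) }
  IsT⇒Dp⇔Dp* (t-zero ¬p _) = mk⇔ (λ p → ⊥-elim (¬p p)) λ { (inj₁ ()) ; (inj₂ ()) }

  IsT⇒Dc⇔Dc* : ∀ {α x} → IsT Dp Dc α x → Dc α ⇔ Dc* x
  IsT⇒Dc⇔Dc* (t-one _ c)  = mk⇔ (λ _ → inj₁ refl) (λ _ → c)
  IsT⇒Dc⇔Dc* (t-hp _ ¬c)  = mk⇔ (λ c → ⊥-elim (¬c c)) λ { (inj₁ ()) ; (inj₂ ()) }
  IsT⇒Dc⇔Dc* (t-hc _ c)   = mk⇔ (λ _ → inj₂ refl) (λ _ → c)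
  IsT⇒Dc⇔Dc* (t-zero _ ¬c) = mk⇔ (λ c → ⊥-elim (¬c c)) λ { (inj₁ ()) ; (inj₂ ()) }

module _ {L : Logic} (M N : Semantics L) where
  open Logic L using (Atom; Con; ar)
  private
    module M = Semantics M
    module N = Semantics N

  at-image-⊆ : ∀ {P : Pred M.V 0ℓ} {P′ : Pred N.V 0ℓ} {w w′} →
    (∀ F → P′ (N.⟦ F ⟧ w′) → P (M.⟦ F ⟧ w)) →
    ∀ {Γ : Pred (Formula Atom Con ar) 0ℓ} →
    at (image N Γ) w′ ⊆ P′ → at (image M Γ) w ⊆ P
  at-image-⊆ {w′ = w′} P′⇒P Γ⊆P′ (_ , (F , F∈Γ , refl) , refl) =
    P′⇒P F (Γ⊆P′ (N.⟦ F ⟧ , (F , F∈Γ , refl) , refl))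

  at-image-meets : ∀ {Q : Pred M.V 0ℓ} {Q′ : Pred N.V 0ℓ} {w w′} →
    (∀ F → Q (M.⟦ F ⟧ w) → Q′ (N.⟦ F ⟧ w′)) →
    ∀ {Δ : Pred (Formula Atom Con ar) 0ℓ} →
    (∃ λ α → α ∈ at (image M Δ) w × α ∈ Q) →
    (∃ λ α → α ∈ at (image N Δ) w′ × α ∈ Q′)
  at-image-meets {w′ = w′} Q⇒Q′ (_ , (_ , (F , F∈Δ , refl) , refl) , QF) =
    N.⟦ F ⟧ w′ , (N.⟦ F ⟧ , (F , F∈Δ , refl) , refl) , Q⇒Q′ F QF

  ⊩-transfer :
    ∀ {Dp Dc : Pred M.V 0ℓ} {Dp′ Dc′ : Pred N.V 0ℓ} {w w′} →
    (∀ F → Dp′ (N.⟦ F ⟧ w′) → Dp (M.⟦ F ⟧ w)) →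
    (∀ F → Dc (M.⟦ F ⟧ w) → Dc′ (N.⟦ F ⟧ w′)) →
    ∀ {Γ Δ : Pred (Formula Atom Con ar) 0ℓ} →
    ⊩[ Dp , Dc ] (at (image M Γ) w) (at (image M Δ) w) →
    ⊩[ Dp′ , Dc′ ] (at (image N Γ) w′) (at (image N Δ) w′)
  ⊩-transfer premises conclusions ⊩Γ,Δ =
    at-image-meets conclusions ∘ ⊩Γ,Δ ∘ at-image-⊆ premises

module _ {L : Logic} (M : Semantics L) (Λ : Set) (Dp Dc : Λ → Pred (Semantics.V M) 0ℓ)
         (int : Formula (Logic.Atom L) (Logic.Con L) (Logic.ar L) → (Λ × Semantics.W M) → V*)
         (int-IsT : ∀ F l v → IsT (Dp l) (Dc l) (Semantics.⟦_⟧ M F v) (int F (l , v)))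
         (intc : (c : Logic.Con L) → (Fin (Logic.ar L c) → ((Λ × Semantics.W M) → V*)) →
                   ((Λ × Semantics.W M) → V*)) where
  private
    M* = SSReduction M Λ int intc

  ⊩-SSReduction⇔ : ∀ {Γ Δ} l v →
    ⊩[ Dp l , Dc l ] (at (image M Γ) v) (at (image M Δ) v) ⇔
    ⊩[ Dp* , Dc* ] (at (image M* Γ) (l , v)) (at (image M* Δ) (l , v))
  ⊩-SSReduction⇔ l v = mk⇔
    (⊩-transfer M M* (λ F → Equivalence.from (IsT⇒Dp⇔Dp* (int-IsT F l v)))
                     (λ F → Equivalence.to   (IsT⇒Dc⇔Dc* (int-IsT F l v))))
    (⊩-transfer M* M (λ F → Equivalence.to   (IsT⇒Dp⇔Dp* (int-IsT F l v)))
                     (λ F → Equivalence.from (IsT⇒Dc⇔Dc* (int-IsT F l v))))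

  ⋂⊩⇔⊨-SSReduction : ∀ {Γ Δ} →
    (∀ v → ⋂⊩ Dp Dc (at (image M Γ) v) (at (image M Δ) v)) ⇔
    Semantics._⊨_ M* (image M* Γ) (image M* Δ)
  ⋂⊩⇔⊨-SSReduction = mk⇔
    (λ ⊩ → uncurry λ l v → Equivalence.to (⊩-SSReduction⇔ l v) (⊩ v l))
    (λ ⊩* v l → Equivalence.from (⊩-SSReduction⇔ l v) (⊩* (l , v)))

theorem4p4 : (L : Logic) (M : Semantics L) →
    SoundComplete M →
    (Λ : Set) (Dp Dc : Λ → Pred (Semantics.V M) 0ℓ) →
    TruthRelationalWith M (⋂⊩ Dp Dc) →
    (int : Formula (Logic.Atom L) (Logic.Con L) (Logic.ar L) → (Λ × Semantics.W M) → V*) →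
    (∀ F l v → IsT (Dp l) (Dc l) (Semantics.⟦_⟧ M F v) (int F (l , v))) →
    (intc : (c : Logic.Con L) → (Fin (Logic.ar L c) → ((Λ × Semantics.W M) → V*)) →
    ((Λ × Semantics.W M) → V*)) →
    SoundComplete (SSReduction M Λ int intc) × Mixed (SSReduction M Λ int intc)
theorem4p4 L M soundComplete Λ Dp Dc truthRelational int int-IsT intc =
  (λ Γ Δ → ⋂⊩⇔⊨-SSReduction M Λ Dp Dc int int-IsT intc
             ⇔-∘ (truthRelational _ _ ⇔-∘ soundComplete Γ Δ))
  , Dp* , Dc* , (λ _ _ → ⇔-id _)
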